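{- For any integer $k\ge 1$ and any prime $p\le k$, we have $p^{a_p(k)}\ge k$.
   Context: For a prime $p$ and integer $m$, $\nu_p(m)$ denotes the largest $r$ with $p^r\mid m$, with $\nu_p(0)=\infty$. Let $e_p(k)=\nu_p(k!)$ and, for integers $n$, $f_{p,k}(n)=\sum_{j=0}^{k-1}\nu_p(n-j)$. Define $a_p(k)$ to be the smallest integer $m\ge 0$ such that whether or not $f_{p,k}(n)\ge 2e_p(k)$ holds depends only on the congruence class of $n$ modulo $p^m$. -}

module Defs where

open import Data.Nat using (ℕ; zero; suc; _+_; _*_; _^_; _≤_; _<_; _!)
open import Data.Nat.Divisibility using (_∣?_)
open import Data.Integer as ℤ using (ℤ; +_; ∣_∣; _-_)
import Data.Integer.Divisibility as ℤD
open import Relation.Nullary using (yes; no)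
open import Function.Bundles using (_⇔_)

-- ℕ extended with ∞ (for ν_p(0) = ∞)
data ℕ∞ : Set where
  fin : ℕ → ℕ∞
  ∞   : ℕ∞

_+∞_ : ℕ∞ → ℕ∞ → ℕ∞
fin a +∞ fin b = fin (a + b)
fin _ +∞ ∞     = ∞
∞     +∞ _     = ∞

data _≤∞_ : ℕ∞ → ℕ∞ → Set where
  fin≤fin : ∀ {a b} → a ≤ b → fin a ≤∞ fin b
  _≤∞∞    : ∀ x → x ≤∞ ∞

largestPow : ℕ → ℕ → ℕ → ℕ
largestPow p m zero = zero
largestPow p m (suc r) with (p ^ suc r) ∣? m
... | yes _ = suc r
... | no  _ = largestPow p m r

-- ν_p on positive naturals: largest r with p^r ∣ m.
-- For p ≥ 2 and m ≥ 1 any such r satisfies r < m, so searching r ≤ m suffices.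
νℕ : ℕ → ℕ → ℕ
νℕ p m = largestPow p m m

ν : ℕ → ℤ → ℕ∞
ν p (+ zero) = ∞
ν p m        = fin (νℕ p ∣ m ∣)

e : ℕ → ℕ → ℕ
e p k = νℕ p (k !)

f : ℕ → ℕ → ℤ → ℕ∞
f p zero    n = fin 0
f p (suc k) n = f p k n +∞ ν p (n - + k)

Cond : ℕ → ℕ → ℤ → Set
Cond p k n = fin (2 * e p k) ≤∞ f p k n

DependsOnlyMod : ℕ → ℕ → ℕ → Set
DependsOnlyMod p k m =
  ∀ (n n' : ℤ) → (+ (p ^ m)) ℤD.∣ (n - n') → (Cond p k n ⇔ Cond p k n')

IsA : ℕ → ℕ → ℕ → Set
IsA p k a = DependsOnlyMod p k a × (∀ m → DependsOnlyMod p k m → a ≤ m)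
  where open import Data.Product using (_×_)

module Submission where

-- Let q = p ^ a, where a = a_p(k), and suppose q < k.
--   * For 0 ≤ r < k one of the factors r, r - 1, …, r - k + 1 is 0, so
--     f_{p,k}(r) = ∞ and the condition f_{p,k}(r) ≥ 2 e_p(k) holds trivially.
--   * k ≡ k - q (mod q) and 0 ≤ k - q < k; since the condition only depends
--     on n mod q, it therefore holds at n = k as well.
--   * But f_{p,k}(k) = Σ_{j<k} ν_p(k - j) is the valuation of k!, i.e. e_p(k).
--     We only need the inequality f_{p,k}(k) ≤ e_p(k), which follows from
--     p ^ f_{p,j}(m + j) · m! ∣ (m + j)!  (induction on j) together with the
--     maximality of ν_p.  As p ≤ k we have p ∣ k!, so e_p(k) ≥ 1, and
--     2 e_p(k) ≤ e_p(k) is impossible.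

open import Defs
open import Data.Nat using (ℕ; _≤_; _^_)
open import Data.Nat.Primality using (Prime; prime⇒nonTrivial)

open import Data.Nat using (zero; suc; _+_; _*_; _∸_; _<_; _!; NonZero; z≤n; s≤s; s≤s⁻¹; _≤?_; nonTrivial⇒n>1; >-nonZero; z<s)
open import Data.Nat.Properties
open import Data.Nat.Divisibility
  using (_∣_; _∣?_; divides; ∣-refl; ∣-trans; ∣⇒≤; m∣m*n; *-monoʳ-∣; *-monoˡ-∣; m≤n⇒m!∣n!; module ∣-Reasoning)
open import Data.Integer using (+_; _-_)
open import Data.Integer.Properties using ([+m]-[+n]≡m⊖n; ⊖-≥; n⊖n≡0)
import Data.Integer.Divisibility as ℤ
open import Data.Product using (Σ; _,_; _×_)
open import Data.Sum using (inj₁; inj₂)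
open import Data.Empty using (⊥-elim)
open import Relation.Nullary using (yes; no; ¬_)
open import Relation.Binary.PropositionalEquality using (_≡_; refl; sym; trans; subst; cong; cong₂; module ≡-Reasoning)
open import Function.Bundles using (Equivalence)

largestPow-divides : ∀ p m b → p ^ largestPow p m b ∣ m
largestPow-divides p m zero = divides m (sym (*-identityʳ m))
largestPow-divides p m (suc b) with (p ^ suc b) ∣? m
... | yes p^b+1∣m = p^b+1∣m
... | no  _       = largestPow-divides p m b

largestPow-maximal : ∀ p m b r → p ^ r ∣ m → r ≤ b → r ≤ largestPow p m b
largestPow-maximal p m zero    r p^r∣m z≤n = z≤n
largestPow-maximal p m (suc b) r p^r∣m r≤b+1 with (p ^ suc b) ∣? m
... | yes _         = r≤b+1
... | no  p^b+1∤m with m≤n⇒m<n∨m≡n r≤b+1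
...   | inj₁ r<b+1 = largestPow-maximal p m b r p^r∣m (s≤s⁻¹ r<b+1)
...   | inj₂ refl  = ⊥-elim (p^b+1∤m p^r∣m)

exponent<power : ∀ p → 1 < p → ∀ r → r < p ^ r
exponent<power p 1<p zero    = s≤s z≤n
exponent<power p 1<p (suc r) = ≤-<-trans (exponent<power p 1<p r) (^-monoʳ-< p 1<p (n<1+n r))

-- Maximality of ν_p on positive integers: the search bound m is large enough,
-- since p ^ r ∣ m forces r < p ^ r ≤ m.
νℕ-maximal : ∀ p m r → 1 < p → .{{NonZero m}} → p ^ r ∣ m → r ≤ νℕ p m
νℕ-maximal p m r 1<p p^r∣m =
  largestPow-maximal p m m r p^r∣m (<⇒≤ (<-≤-trans (exponent<power p 1<p r) (∣⇒≤ p^r∣m)))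

-- A prime p ≤ k divides k!, so e_p(k) ≥ 1.
e-positive : ∀ p k → 1 < p → p ≤ k → 1 ≤ e p k
e-positive p@(suc p-1) k 1<p p≤k =
  νℕ-maximal p (k !) 1 1<p {{k !≢0}} (∣-trans p^1∣p! (m≤n⇒m!∣n! p≤k))
  where
  p^1∣p! : p ^ 1 ∣ p !
  p^1∣p! rewrite *-identityʳ p = m∣m*n (p-1 !)

+-∸ : ∀ {m n} → n ≤ m → + m - + n ≡ + (m ∸ n)
+-∸ {m} {n} n≤m = trans ([+m]-[+n]≡m⊖n m n) (⊖-≥ n≤m)

-- If 0 ≤ r < j, the window r, r - 1, …, r - j + 1 contains 0, so f_{p,j}(r) = ∞.
f-window-hits-zero : ∀ p j r → r < j → f p j (+ r) ≡ ∞
f-window-hits-zero p (suc j) r r<j+1 with m≤n⇒m<n∨m≡n (s≤s⁻¹ r<j+1)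
... | inj₁ r<j rewrite f-window-hits-zero p j r r<j = refl
... | inj₂ refl rewrite [+m]-[+n]≡m⊖n r r | n⊖n≡0 r with f p r (+ r)
...   | fin _ = refl
...   | ∞     = refl

-- The window m + j, …, m + 1 consists of positive integers, so f_{p,j}(m + j)
-- is a finite exponent s, and p ^ s · m! divides (m + j)! = (m + j)⋯(m + 1) · m!.
f-falling-factorial : ∀ p j m →
  Σ ℕ λ s → (f p j (+ (m + j)) ≡ fin s) × (p ^ s * m ! ∣ (m + j) !)
f-falling-factorial p zero m =
  0 , cong (λ x → f p 0 (+ x)) (+-identityʳ m) , divides-m!
  where
  divides-m! : 1 * m ! ∣ (m + 0) !
  divides-m! rewrite +-identityʳ m | *-identityˡ (m !) = ∣-refl
f-falling-factorial p (suc j) m with f-falling-factorial p j (suc m)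
... | s , f≡s , p^s*[m+1]!∣ = s + t , f≡s+t , p^[s+t]*m!∣
  where
  t : ℕ
  t = νℕ p (suc m)

  f≡s+t : f p (suc j) (+ (m + suc j)) ≡ fin (s + t)
  f≡s+t = begin
    f p (suc j) (+ (m + suc j))
      ≡⟨ cong (λ x → f p (suc j) (+ x)) (+-suc m j) ⟩
    f p j (+ (suc m + j)) +∞ ν p (+ (suc m + j) - + j)
      ≡⟨ cong₂ _+∞_ f≡s (cong (ν p) (+-∸ (m≤n+m j (suc m)))) ⟩
    fin s +∞ ν p (+ (suc m + j ∸ j))
      ≡⟨ cong (λ x → fin s +∞ ν p (+ x)) (m+n∸n≡m (suc m) j) ⟩
    fin (s + t) ∎
    where open ≡-Reasoning

  p^[s+t]*m!∣ : p ^ (s + t) * m ! ∣ (m + suc j) !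
  p^[s+t]*m!∣ rewrite +-suc m j = begin
    p ^ (s + t) * m !      ≡⟨ cong (_* m !) (^-distribˡ-+-* p s t) ⟩
    p ^ s * p ^ t * m !    ≡⟨ *-assoc (p ^ s) (p ^ t) (m !) ⟩
    p ^ s * (p ^ t * m !)  ∣⟨ *-monoʳ-∣ (p ^ s) (*-monoˡ-∣ (m !) (largestPow-divides p (suc m) (suc m))) ⟩
    p ^ s * (suc m) !      ∣⟨ p^s*[m+1]!∣ ⟩
    (suc m + j) !          ∎
    where open ∣-Reasoning

f-at-k-bounded : ∀ p k → 1 < p → Σ ℕ λ s → (f p k (+ k) ≡ fin s) × (s ≤ e p k)
f-at-k-bounded p k 1<p with f-falling-factorial p k 0
... | s , f≡s , p^s*0!∣k! =
  s , f≡s , νℕ-maximal p (k !) s 1<p {{k !≢0}} (subst (_∣ k !) (*-identityʳ (p ^ s)) p^s*0!∣k!)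

cond-below-k : ∀ p k r → r < k → Cond p k (+ r)
cond-below-k p k r r<k rewrite f-window-hits-zero p k r r<k = _ ≤∞∞

-- At k the condition fails: it would give 2 e_p(k) ≤ f_{p,k}(k) ≤ e_p(k),
-- contradicting e_p(k) ≥ 1.
not-cond-at-k : ∀ p k → 1 < p → p ≤ k → ¬ Cond p k (+ k)
not-cond-at-k p k 1<p p≤k cond with f-at-k-bounded p k 1<p
... | s , f≡s , s≤e rewrite f≡s with cond
...   | fin≤fin 2e≤s = <⇒≱ e<2e (≤-trans 2e≤s s≤e)
  where
  e<2e : e p k < 2 * e p k
  e<2e rewrite +-identityʳ (e p k) = m<m+n (e p k) (e-positive p k 1<p p≤k)

congruent-shift : ∀ k q → q ≤ k → (+ q) ℤ.∣ (+ k - + (k ∸ q))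
congruent-shift k q q≤k rewrite +-∸ (m∸n≤m k q) | m∸[m∸n]≡n q≤k = ∣-refl

lemma2 : ∀ (k p : ℕ) → 1 ≤ k → Prime p → p ≤ k →
    ∀ (a : ℕ) → IsA p k a → k ≤ p ^ a
lemma2 k p _ p-prime p≤k a (dependsOnly , _) with k ≤? p ^ a
... | yes k≤q = k≤q
... | no  k≰q = ⊥-elim (not-cond-at-k p k 1<p p≤k cond-at-k)
  where
  1<p : 1 < p
  1<p = nonTrivial⇒n>1 p {{prime⇒nonTrivial p-prime}}

  q<k : p ^ a < k
  q<k = ≰⇒> k≰q

  -- k - p^a lies in [0, k), where the condition holds; transport it to k
  k∸q<k : k ∸ p ^ a < k
  k∸q<k = ∸-monoʳ-< (m^n>0 p {{>-nonZero (<-trans z<s 1<p)}} a) (<⇒≤ q<k)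

  cond-at-k : Cond p k (+ k)
  cond-at-k = Equivalence.from (dependsOnly (+ k) (+ (k ∸ p ^ a)) (congruent-shift k (p ^ a) (<⇒≤ q<k)))
                               (cond-below-k p k (k ∸ p ^ a) k∸q<k)
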